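{- Let $d\geq 2$ and $\gamma\geq 1$ be integers. Then $k(d,\gamma)\leq \lfloor d/2\rfloor$.
   Context: A graph $G=(V,E)$ is $k$-linked if $|V|\geq 2k$ and for every choice of $2k$ distinct vertices $s_1,\dots,s_k,t_1,\dots,t_k$ there exist $k$ pairwise vertex-disjoint paths $L_1,\dots,L_k$ with $L_i$ joining $s_i$ and $t_i$; a polytope is $k$-linked if its graph (vertices and edges) is. For a polytope $P$, $k(P)=\max\{k : P \text{ is } k\text{ -linked}\}$. For $d,\gamma\geq 0$ let $\mathcal{P}_d^\gamma$ be the class of $d$-polytopes with $d+\gamma+1$ vertices (up to combinatorial equivalence), and $k(d,\gamma)=\max\{k : k(P)\geq k \text{ for all } P\in\mathcal{P}_d^\gamma\}$. -}

module Defs where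

open import Data.Nat using (ℕ; zero; suc; _*_) renaming (_≤_ to _≤ℕ_)
open import Data.Fin using (Fin; zero; suc)
open import Data.Rational using (ℚ; 0ℚ; _<_) renaming (_+_ to _+ℚ_; _*_ to _*ℚ_)
open import Data.Product using (Σ; ∃; _×_; _,_)
open import Data.List using (List; []; _∷_)
open import Data.List.Relation.Unary.Unique.Propositional using (Unique)
open import Data.List.Membership.Propositional using (_∈_)
open import Relation.Binary.PropositionalEquality using (_≡_; _≢_)

dot : ∀ {d} → (Fin d → ℚ) → (Fin d → ℚ) → ℚ
dot {zero}  c x = 0ℚ
dot {suc d} c x = (c zero *ℚ x zero) +ℚ dot (λ i → c (suc i)) (λ i → x (suc i))

-- A configuration v of n points in ℚ^d is the vertex set of a d-polytope
-- P = conv{v 0, …, v (n-1)} with exactly these n vertices when: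
--  * every v i is a vertex (0-face) of P: some linear functional attains
--    its maximum over P uniquely at v i;
--  * P is d-dimensional: its affine hull is all of ℚ^d, i.e. the only linear
--    functional constant on all points is the zero functional.
IsVertex : ∀ {d n} → (Fin n → Fin d → ℚ) → Fin n → Set
IsVertex v i = ∃ λ c → ∀ j → j ≢ i → dot c (v j) < dot c (v i)

FullDim : ∀ {d n} → (Fin n → Fin d → ℚ) → Set
FullDim {d} v = ∀ (c : Fin d → ℚ) → (∀ i j → dot c (v i) ≡ dot c (v j)) → ∀ k → c k ≡ 0ℚ

IsPolytope : (d n : ℕ) → (Fin n → Fin d → ℚ) → Set
IsPolytope d n v = (∀ i → IsVertex v i) × FullDim v

Edge : ∀ {d n} → (Fin n → Fin d → ℚ) → Fin n → Fin n → Set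
Edge v i j = (i ≢ j) × ∃ λ c → (dot c (v i) ≡ dot c (v j))
                         × (∀ k → k ≢ i → k ≢ j → dot c (v k) < dot c (v i))

data Walk {n : ℕ} (E : Fin n → Fin n → Set) : Fin n → Fin n → Set where
  here : ∀ {s} → Walk E s s
  step : ∀ {s u t} → E s u → Walk E u t → Walk E s t

verts : ∀ {n} {E : Fin n → Fin n → Set} {s t} → Walk E s t → List (Fin n)
verts {s = s} here       = s ∷ []
verts {s = s} (step e w) = s ∷ verts w

Distinct2k : ∀ {n k} → (Fin k → Fin n) → (Fin k → Fin n) → Set
Distinct2k {k = k} s t =
  (∀ i j → s i ≡ s j → i ≡ j) × (∀ i j → t i ≡ t j → i ≡ j) × (∀ (i j : Fin k) → s i ≢ t j)

Linked : ∀ {n} → (Fin n → Fin n → Set) → ℕ → Set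
Linked {n} E k =
  (2 * k ≤ℕ n) ×
  (∀ (s t : Fin k → Fin n) → Distinct2k s t →
     Σ ((i : Fin k) → Walk E (s i) (t i)) λ L →
       (∀ i → Unique (verts (L i))) ×
       (∀ i j x → x ∈ verts (L i) → x ∈ verts (L j) → i ≡ j))

module Submission where

-- For a D-polytope, D ≥ 2, take the γ+3 ≥ 4 points (p, p², 0, …, 0) of a parabola in the first
-- coordinate plane together with the D − 2 unit vectors of the remaining axes. A linear functional
-- certifying an edge from parabola vertex b+1 to parabola vertex j restricts to a quadratic sequence
-- in p that is smaller at b and b+2 than at b+1 (unless j is one of them), hence concave with strict
-- maximum at b+1, contradicting the tie at j. So the parabola vertex 1 is adjacent only to 0, 2 and
-- the axis vertices, and 2 only to 1, 3 and the axis vertices. Once k > ⌊D/2⌋ there are 2k ≥ D + 1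
-- terminals: pair 1 with 3, 2 with 0, and use all axis vertices but one as terminals. The paths
-- starting at 1 and at 2 must then both leave through that single free axis vertex.

open import Defs

module Concavity where
  open import Data.Nat as ℕ using (ℕ; suc; _≤′_; ≤′-refl; ≤′-step)
  import Data.Nat.Properties as ℕ
  open import Data.Rational using (ℚ; _+_; _<_; _≤_)
  open import Data.Rational.Properties using (≰⇒>; <-trans; <-irrefl; <-≤-trans; +-mono-<-≤; +-mono-≤-<)
  open import Data.Product using (_×_; _,_; proj₂)
  open import Data.Empty using (⊥-elim)
  open import Relation.Binary.PropositionalEquality using (_≡_; _≢_; refl)
  open import Relation.Binary.Definitions using (tri<; tri≈; tri>)

  Concave : (ℕ → ℚ) → Set
  Concave F = ∀ m → F m + F (suc (suc m)) ≤ F (suc m) + F (suc m)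

  module _ {F : ℕ → ℚ} (concave : Concave F) where

    drop⇒next-drop : ∀ {m} → F (suc m) < F m → F (suc (suc m)) < F (suc m)
    drop⇒next-drop {m} drop = ≰⇒> λ rise → <-irrefl refl (<-≤-trans (+-mono-<-≤ drop rise) (concave m))

    rise⇒previous-rise : ∀ {m} → F (suc m) < F (suc (suc m)) → F m < F (suc m)
    rise⇒previous-rise {m} rise = ≰⇒> λ drop → <-irrefl refl (<-≤-trans (+-mono-≤-< drop rise) (concave m))

    drop⇒<-after : ∀ {b} → F (suc b) < F b → ∀ {j} → b ℕ.< j → F j < F b
    drop⇒<-after {b} drop (ℕ.s≤s b≤j) = proj₂ (descending (ℕ.≤⇒≤′ b≤j))
      where
      descending : ∀ {j} → b ≤′ j → F (suc j) < F j × F (suc j) < F b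
      descending ≤′-refl = drop , drop
      descending (≤′-step b≤j) with descending b≤j
      ... | next , below = drop⇒next-drop next , <-trans (drop⇒next-drop next) below

    rise⇒<-before : ∀ {m} → F m < F (suc m) → ∀ {j} → j ≤′ m → F j < F (suc m)
    rise⇒<-before rise ≤′-refl = rise
    rise⇒<-before rise (≤′-step j≤m) = <-trans (rise⇒<-before (rise⇒previous-rise rise) j≤m) rise

    peak⇒strict-max : ∀ {b} → F b < F (suc b) → F (suc (suc b)) < F (suc b) →
                      ∀ j → j ≢ suc b → F j < F (suc b)
    peak⇒strict-max {b} rise drop j j≢peak with ℕ.<-cmp j (suc b)
    ... | tri< (ℕ.s≤s j≤b) _ _ = rise⇒<-before rise (ℕ.≤⇒≤′ j≤b)
    ... | tri≈ _ j≡peak _       = ⊥-elim (j≢peak j≡peak)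
    ... | tri> _ _ peak<j       = drop⇒<-after drop peak<j

module Quadratics where
  open Concavity
  open import Data.Nat as ℕ using (ℕ; zero; suc)
  import Data.Nat.Properties as ℕ
  open import Data.Rational using (ℚ; 0ℚ; 1ℚ; ½; _+_; _*_; -_; _<_; _≤_)
  open import Data.Rational.Properties
  open import Data.Product using (_×_; _,_)
  open import Data.Empty using (⊥-elim)
  open import Relation.Nullary.Decidable using (dec⇒maybe)
  open import Level using (0ℓ)
  open import Relation.Binary.PropositionalEquality
  open import Relation.Binary.Definitions using (tri<; tri≈; tri>)
  open import Tactic.RingSolver using (solve-∀)
  open import Tactic.RingSolver.Core.AlmostCommutativeRing using (AlmostCommutativeRing; fromCommutativeRing)

  ℚ-ring : AlmostCommutativeRing 0ℓ 0ℓ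
  ℚ-ring = fromCommutativeRing +-*-commutativeRing (λ x → dec⇒maybe (0ℚ ≟ x))

  -- Recursive, so that fromℕ (suc m) unfolds to 1ℚ + fromℕ m for the ring solver.
  fromℕ : ℕ → ℚ
  fromℕ zero    = 0ℚ
  fromℕ (suc m) = 1ℚ + fromℕ m

  quad : ℚ → ℚ → ℕ → ℚ
  quad a b m = a * fromℕ m + b * (fromℕ m * fromℕ m)

  quad-at-zero : ∀ a b → quad a b 0 ≡ 0ℚ
  quad-at-zero a b = identity a b
    where
    identity : ∀ a b → a * 0ℚ + b * (0ℚ * 0ℚ) ≡ 0ℚ
    identity = solve-∀ ℚ-ring

  quad-zero-coefficients : ∀ m → quad 0ℚ 0ℚ m ≡ 0ℚ
  quad-zero-coefficients m = identity (fromℕ m)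
    where
    identity : ∀ t → 0ℚ * t + 0ℚ * (t * t) ≡ 0ℚ
    identity = solve-∀ ℚ-ring

  quad-second-difference : ∀ a b m →
    quad a b m + quad a b (suc (suc m)) ≡ (quad a b (suc m) + quad a b (suc m)) + (b + b)
  quad-second-difference a b m = identity a b (fromℕ m)
    where
    identity : ∀ a b t → let q : ℚ → ℚ
                             q s = a * s + b * (s * s)
                         in q t + q (1ℚ + (1ℚ + t)) ≡ (q (1ℚ + t) + q (1ℚ + t)) + (b + b)
    identity = solve-∀ ℚ-ring

  quad-concave : ∀ {a b} → b + b ≤ 0ℚ → Concave (quad a b)
  quad-concave {a} {b} b+b≤0 m = begin
    quad a b m + quad a b (suc (suc m))         ≡⟨ quad-second-difference a b m ⟩
    quad a b (suc m) + quad a b (suc m) + (b + b) ≤⟨ +-monoʳ-≤ (quad a b (suc m) + quad a b (suc m)) b+b≤0 ⟩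
    quad a b (suc m) + quad a b (suc m) + 0ℚ      ≡⟨ +-identityʳ _ ⟩
    quad a b (suc m) + quad a b (suc m)           ∎
    where open ≤-Reasoning

  quad-peak⇒concave : ∀ {a b m} → quad a b m < quad a b (suc m) → quad a b (suc (suc m)) < quad a b (suc m) →
                      Concave (quad a b)
  quad-peak⇒concave {a} {b} {m} rise drop = quad-concave {a} {b} (≮⇒≥ λ b+b>0 → <-asym peak (above b+b>0))
    where
    peak : quad a b m + quad a b (suc (suc m)) < quad a b (suc m) + quad a b (suc m)
    peak = +-mono-< rise drop
    above : 0ℚ < b + b → quad a b (suc m) + quad a b (suc m) < quad a b m + quad a b (suc (suc m))
    above b+b>0 = begin-strict
      quad a b (suc m) + quad a b (suc m)          ≡⟨ sym (+-identityʳ _) ⟩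
      quad a b (suc m) + quad a b (suc m) + 0ℚ     <⟨ +-monoʳ-< (quad a b (suc m) + quad a b (suc m)) b+b>0 ⟩
      quad a b (suc m) + quad a b (suc m) + (b + b) ≡⟨ sym (quad-second-difference a b m) ⟩
      quad a b m + quad a b (suc (suc m))          ∎
      where open ≤-Reasoning

  quad-peak⇒strict-max : ∀ {a b m} → quad a b m < quad a b (suc m) → quad a b (suc (suc m)) < quad a b (suc m) →
                         ∀ j → j ≢ suc m → quad a b j < quad a b (suc m)
  quad-peak⇒strict-max {a} {b} {m} rise drop =
    peak⇒strict-max {quad a b} (quad-peak⇒concave {a} {b} {m} rise drop) rise drop

  quad-roots : ∀ {a b} → quad a b 1 ≡ 0ℚ → quad a b 2 ≡ 0ℚ → a ≡ 0ℚ × b ≡ 0ℚ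
  quad-roots {a} {b} root₁ root₂ = a≡0 , b≡0
    where
    b-identity : ∀ a b → let q : ℚ → ℚ
                             q s = a * s + b * (s * s)
                         in b ≡ ½ * (q (fromℕ 2) + - (q (fromℕ 1) + q (fromℕ 1)))
    b-identity = solve-∀ ℚ-ring
    a-identity : ∀ a b → a ≡ (a * fromℕ 1 + b * (fromℕ 1 * fromℕ 1)) + - b
    a-identity = solve-∀ ℚ-ring
    b≡0 : b ≡ 0ℚ
    b≡0 = trans (b-identity a b) (cong₂ (λ q₂ q₁ → ½ * (q₂ + - (q₁ + q₁))) root₂ root₁)
    a≡0 : a ≡ 0ℚ
    a≡0 = trans (a-identity a b) (cong₂ (λ q₁ b → q₁ + - b) root₁ b≡0)

  x<x+1 : ∀ x → x < x + 1ℚ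
  x<x+1 x = begin-strict
    x        ≡⟨ sym (+-identityʳ x) ⟩
    x + 0ℚ   <⟨ +-monoʳ-< x (positive⁻¹ 1ℚ) ⟩
    x + 1ℚ   ∎
    where open ≤-Reasoning

  peakAt : ℕ → ℕ → ℚ
  peakAt p = quad (fromℕ p + fromℕ p) (- 1ℚ)

  peakAt-concave : ∀ p → Concave (peakAt p)
  peakAt-concave p = quad-concave {fromℕ p + fromℕ p} { - 1ℚ} (≤ᵇ⇒≤ _)

  peakAt-right : ∀ p → peakAt p (suc p) + 1ℚ ≡ peakAt p p
  peakAt-right p = identity (fromℕ p)
    where
    identity : ∀ t → let q : ℚ → ℚ
                         q s = (t + t) * s + - 1ℚ * (s * s)
                     in q (1ℚ + t) + 1ℚ ≡ q t
    identity = solve-∀ ℚ-ring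

  peakAt-left : ∀ p → peakAt (suc p) p + 1ℚ ≡ peakAt (suc p) (suc p)
  peakAt-left p = identity (fromℕ p)
    where
    identity : ∀ t → let q : ℚ → ℚ
                         q s = ((1ℚ + t) + (1ℚ + t)) * s + - 1ℚ * (s * s)
                     in q t + 1ℚ ≡ q (1ℚ + t)
    identity = solve-∀ ℚ-ring

  peakAt-strict-max : ∀ p j → j ≢ p → peakAt p j < peakAt p p
  peakAt-strict-max p j j≢p with ℕ.<-cmp j p
  ... | tri≈ _ j≡p _ = ⊥-elim (j≢p j≡p)
  ... | tri> _ _ p<j = drop⇒<-after {peakAt p} (peakAt-concave p) drop p<j
    where
    drop : peakAt p (suc p) < peakAt p p
    drop = subst (peakAt p (suc p) <_) (peakAt-right p) (x<x+1 _)
  peakAt-strict-max (suc q) j _ | tri< (ℕ.s≤s j≤q) _ _ =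
    rise⇒<-before {peakAt (suc q)} (peakAt-concave (suc q)) rise (ℕ.≤⇒≤′ j≤q)
    where
    rise : peakAt (suc q) q < peakAt (suc q) (suc q)
    rise = subst (peakAt (suc q) q <_) (peakAt-left q) (x<x+1 _)

module Coordinates where
  open import Data.Nat using (zero; suc)
  open import Data.Fin using (Fin; zero; suc)
  open import Data.Rational using (ℚ; 0ℚ; 1ℚ; _+_; _*_)
  open import Data.Rational.Properties using (*-zeroʳ; *-identityʳ; +-identityˡ; +-identityʳ)
  open import Data.Empty using (⊥-elim)
  open import Relation.Binary.PropositionalEquality

  basis : ∀ {d} → Fin d → Fin d → ℚ
  basis zero    zero    = 1ℚ
  basis zero    (suc _) = 0ℚ
  basis (suc _) zero    = 0ℚ
  basis (suc k) (suc j) = basis k j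

  basis-diagonal : ∀ {d} (k : Fin d) → basis k k ≡ 1ℚ
  basis-diagonal zero    = refl
  basis-diagonal (suc k) = basis-diagonal k

  basis-offDiagonal : ∀ {d} {k j : Fin d} → k ≢ j → basis k j ≡ 0ℚ
  basis-offDiagonal {k = zero}  {zero}  k≢j = ⊥-elim (k≢j refl)
  basis-offDiagonal {k = zero}  {suc j} _   = refl
  basis-offDiagonal {k = suc k} {zero}  _   = refl
  basis-offDiagonal {k = suc k} {suc j} k≢j = basis-offDiagonal (λ k≡j → k≢j (cong suc k≡j))

  dot-zeroʳ : ∀ {d} (c : Fin d → ℚ) → dot c (λ _ → 0ℚ) ≡ 0ℚ
  dot-zeroʳ {zero}  c = refl
  dot-zeroʳ {suc d} c = cong₂ _+_ (*-zeroʳ (c zero)) (dot-zeroʳ (λ i → c (suc i)))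

  dot-basis : ∀ {d} (c : Fin d → ℚ) (k : Fin d) → dot c (basis k) ≡ c k
  dot-basis c zero    = trans (cong₂ _+_ (*-identityʳ (c zero)) (dot-zeroʳ (λ i → c (suc i))))
                              (+-identityʳ (c zero))
  dot-basis c (suc k) = trans (cong₂ _+_ (*-zeroʳ (c zero)) (dot-basis (λ i → c (suc i)) k))
                              (+-identityˡ (c (suc k)))

open import Data.Nat using (ℕ; zero; suc; _+_; _*_; _∸_; _≤_; _<_; ⌊_/2⌋; z≤n; s≤s; _<?_)
open import Data.Nat.Properties
  using (≤-trans; ≤-reflexive; ≤-antisym; <-≤-trans; ≤-<-trans; ≮⇒≥; <⇒≢; n<1+n; n≤1+n; suc-injective;
         even≢odd; m+[n∸m]≡n; m≤m+n; +-comm; +-suc; +-monoʳ-≤; *-suc; *-distribˡ-+; *-monoʳ-≤; *-monoʳ-<;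
         *-cancelˡ-≡; *-cancelˡ-<; module ≤-Reasoning)
open import Data.Fin as Fin using (Fin; zero; suc; toℕ; fromℕ<)
open import Data.Fin.Properties using (toℕ-injective; toℕ-fromℕ<; fromℕ<-toℕ; toℕ<n)
open import Data.Rational as ℚ using (ℚ; 0ℚ; 1ℚ; -_)
import Data.Rational.Properties as ℚ
open import Data.Product using (∃; _×_; _,_; proj₁; proj₂)
open import Data.Sum as Sum using (_⊎_; inj₁; inj₂)
open import Data.Empty using (⊥; ⊥-elim)
open import Data.List.Membership.Propositional using (_∈_)
open import Data.List.Relation.Unary.Any as Any using (there)
open import Function using (_∘_)
open import Relation.Nullary using (¬_; yes; no; contradiction)
open import Relation.Binary.PropositionalEquality

open Concavity
open Quadratics
open Coordinates

module Configuration (d : ℕ) where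

  data Label : Set where
    curve : ℕ → Label
    axis  : Fin d → Label

  curve-injective : ∀ {p q} → curve p ≡ curve q → p ≡ q
  curve-injective refl = refl

  point : Label → Fin (2 + d) → ℚ
  point (curve p) zero          = fromℕ p
  point (curve p) (suc zero)    = fromℕ p ℚ.* fromℕ p
  point (curve p) (suc (suc _)) = 0ℚ
  point (axis r)                = basis (suc (suc r))

  dot-curve : ∀ c p → dot c (point (curve p)) ≡ quad (c zero) (c (suc zero)) p
  dot-curve c p = cong (c zero ℚ.* fromℕ p ℚ.+_)
    (trans (cong (c (suc zero) ℚ.* (fromℕ p ℚ.* fromℕ p) ℚ.+_) (dot-zeroʳ (λ i → c (suc (suc i)))))
           (ℚ.+-identityʳ _))

  dot-axis : ∀ c r → dot c (point (axis r)) ≡ c (suc (suc r))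
  dot-axis c r = dot-basis c (suc (suc r))

  -- Index order: parabola vertices 1, 3, 2, 0, then the axis vertices (axis r at 4 + r), then the
  -- remaining parabola vertices. The consecutive terminal pairs thus begin with {1, 3} and {2, 0}.
  label : ℕ → Label
  label 0 = curve 1
  label 1 = curve 3
  label 2 = curve 2
  label 3 = curve 0
  label (suc (suc (suc (suc i)))) with i <? d
  ... | yes i<d = axis (fromℕ< i<d)
  ... | no  _   = curve (4 + (i ∸ d))

  position : Label → ℕ
  position (curve 0)                           = 3
  position (curve 1)                           = 0
  position (curve 2)                           = 2
  position (curve 3)                           = 1
  position (curve (suc (suc (suc (suc p)))))   = 4 + d + p
  position (axis r)                            = 4 + toℕ r

  position-label : ∀ x → position (label x) ≡ x
  position-label 0 = refl
  position-label 1 = refl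
  position-label 2 = refl
  position-label 3 = refl
  position-label (suc (suc (suc (suc i)))) with i <? d
  ... | yes i<d = cong (4 +_) (toℕ-fromℕ< i<d)
  ... | no  i≮d = cong (4 +_) (m+[n∸m]≡n (≮⇒≥ i≮d))

  label-injective : ∀ {x y} → label x ≡ label y → x ≡ y
  label-injective {x} {y} eq = trans (sym (position-label x)) (trans (cong position eq) (position-label y))

  label-axis : ∀ r → label (4 + toℕ r) ≡ axis r
  label-axis r with toℕ r <? d
  ... | yes r<d = cong axis (fromℕ<-toℕ r r<d)
  ... | no  r≮d = ⊥-elim (r≮d (toℕ<n r))

  -- On the parabola this is peakAt p; the value −1 on the axes keeps them below peakAt p p ≥ 0.
  functional : Label → Fin (2 + d) → ℚ
  functional (curve p) zero          = fromℕ p ℚ.+ fromℕ p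
  functional (curve p) (suc _)       = - 1ℚ
  functional (axis r)                = point (axis r)

  peakAt-nonneg : ∀ p → 0ℚ ℚ.≤ peakAt p p
  peakAt-nonneg zero    = ℚ.≤-refl
  peakAt-nonneg (suc p) = ℚ.<⇒≤ (subst (ℚ._< peakAt (suc p) (suc p))
                                        (quad-at-zero (fromℕ (suc p) ℚ.+ fromℕ (suc p)) (- 1ℚ))
                                        (peakAt-strict-max (suc p) 0 λ ()))

  functional-separates : ∀ L L′ → L′ ≢ L → dot (functional L) (point L′) ℚ.< dot (functional L) (point L)
  functional-separates (curve p) (curve q) q≢p =
    subst₂ ℚ._<_ (sym (dot-curve (functional (curve p)) q)) (sym (dot-curve (functional (curve p)) p))
                 (peakAt-strict-max p q (q≢p ∘ cong curve))
  functional-separates (curve p) (axis r) _ =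
    subst₂ ℚ._<_ (sym (dot-axis (functional (curve p)) r)) (sym (dot-curve (functional (curve p)) p))
                 (ℚ.<-≤-trans (ℚ.negative⁻¹ (- 1ℚ)) (peakAt-nonneg p))
  functional-separates (axis r) (curve q) _ =
    subst₂ ℚ._<_ (sym (trans (dot-curve (point (axis r)) q) (quad-zero-coefficients q)))
                 (sym (trans (dot-axis (point (axis r)) r) (basis-diagonal r)))
                 (ℚ.positive⁻¹ 1ℚ)
  functional-separates (axis r) (axis r′) r′≢r =
    subst₂ ℚ._<_ (sym (trans (dot-axis (point (axis r)) r′) (basis-offDiagonal (r′≢r ∘ cong axis ∘ sym))))
                 (sym (trans (dot-axis (point (axis r)) r) (basis-diagonal r)))
                 (ℚ.positive⁻¹ 1ℚ)

module Polytope (d γ : ℕ) where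
  open Configuration d

  n : ℕ
  n = suc (suc d) + suc γ + 1

  v : Fin n → Fin (suc (suc d)) → ℚ
  v i = point (label (toℕ i))

  isVertex : ∀ i → IsVertex v i
  isVertex i = functional (label (toℕ i)) , λ j j≢i →
    functional-separates (label (toℕ i)) (label (toℕ j)) (j≢i ∘ toℕ-injective ∘ label-injective)

  4+d≤n : 4 + d ≤ n
  4+d≤n = subst (4 + d ≤_) (cong (2 +_) (sym (trans (+-comm (d + suc γ) 1) (cong suc (+-suc d γ)))))
                (m≤m+n (4 + d) γ)

  vertex : ∀ x → x ≤ 3 + d → Fin n
  vertex x x≤3+d = fromℕ< (≤-trans (s≤s x≤3+d) 4+d≤n)

  ≤3⇒≤3+d : ∀ {x} → x ≤ 3 → x ≤ 3 + d
  ≤3⇒≤3+d x≤3 = ≤-trans x≤3 (m≤m+n 3 d)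

  label-vertex : ∀ x x≤3+d → label (toℕ (vertex x x≤3+d)) ≡ label x
  label-vertex x x≤3+d = cong label (toℕ-fromℕ< (≤-trans (s≤s x≤3+d) 4+d≤n))

  fullDim : FullDim v
  fullDim c constant = coordinate
    where
    origin : dot c (point (curve 0)) ≡ 0ℚ
    origin = trans (dot-curve c 0) (quad-at-zero (c zero) (c (suc zero)))
    vanishes : ∀ x → x ≤ 3 + d → dot c (point (label x)) ≡ 0ℚ
    vanishes x x≤3+d = begin
      dot c (point (label x))                         ≡⟨ cong (dot c ∘ point) (sym (label-vertex x x≤3+d)) ⟩
      dot c (v (vertex x x≤3+d))                      ≡⟨ constant (vertex x x≤3+d) (vertex 3 (m≤m+n 3 d)) ⟩
      dot c (v (vertex 3 (m≤m+n 3 d)))                ≡⟨ cong (dot c ∘ point) (label-vertex 3 (m≤m+n 3 d)) ⟩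
      dot c (point (curve 0))                         ≡⟨ origin ⟩
      0ℚ                                              ∎
      where open ≡-Reasoning
    roots : c zero ≡ 0ℚ × c (suc zero) ≡ 0ℚ
    roots = quad-roots (trans (sym (dot-curve c 1)) (vanishes 0 z≤n))
                       (trans (sym (dot-curve c 2)) (vanishes 2 (s≤s (s≤s z≤n))))
    coordinate : ∀ k → c k ≡ 0ℚ
    coordinate zero          = proj₁ roots
    coordinate (suc zero)    = proj₂ roots
    coordinate (suc (suc r)) = begin
      c (suc (suc r))                 ≡⟨ sym (dot-axis c r) ⟩
      dot c (point (axis r))          ≡⟨ cong (dot c ∘ point) (sym (label-axis r)) ⟩
      dot c (point (label (4 + toℕ r))) ≡⟨ vanishes (4 + toℕ r) (+-monoʳ-≤ 3 (toℕ<n r)) ⟩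
      0ℚ                              ∎
      where open ≡-Reasoning

  isPolytope : IsPolytope (suc (suc d)) n v
  isPolytope = isVertex , fullDim

  toℕ-by-label : ∀ {x : Fin n} {L} → label (toℕ x) ≡ L → toℕ x ≡ position L
  toℕ-by-label {x} {L} ℓx = trans (sym (position-label (toℕ x))) (cong position ℓx)

  curve-neighbours : ∀ {i u b j} → Edge v i u → label (toℕ i) ≡ curve (suc b) → label (toℕ u) ≡ curve j →
                     (x y : Fin n) → label (toℕ x) ≡ curve b → label (toℕ y) ≡ curve (suc (suc b)) →
                     j ≡ b ⊎ j ≡ suc (suc b)
  curve-neighbours {i} {u} {b} {j} (i≢u , c , level , below) ℓi ℓu x y ℓx ℓy with x Fin.≟ u | y Fin.≟ u
  ... | yes refl | _        = inj₁ (curve-injective (trans (sym ℓu) ℓx))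
  ... | no _     | yes refl = inj₂ (curve-injective (trans (sym ℓu) ℓy))
  ... | no x≢u   | no y≢u   = ⊥-elim (ℚ.<-irrefl (sym (trans (sym (value {i} ℓi)) (trans level (value {u} ℓu))))
                                                 (quad-peak⇒strict-max {c zero} {c (suc zero)} {b} rise drop j j≢1+b))
    where
    value : ∀ {z p} → label (toℕ z) ≡ curve p → dot c (v z) ≡ quad (c zero) (c (suc zero)) p
    value {p = p} ℓz = trans (cong (dot c ∘ point) ℓz) (dot-curve c p)
    ≢i : ∀ {z p} → label (toℕ z) ≡ curve p → p ≢ suc b → z ≢ i
    ≢i {z} ℓz p≢ refl = p≢ (curve-injective (trans (sym ℓz) ℓi))
    rise : quad (c zero) (c (suc zero)) b ℚ.< quad (c zero) (c (suc zero)) (suc b)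
    rise = subst₂ ℚ._<_ (value {x} ℓx) (value {i} ℓi) (below x (≢i ℓx (<⇒≢ (n<1+n b))) x≢u)
    drop : quad (c zero) (c (suc zero)) (suc (suc b)) ℚ.< quad (c zero) (c (suc zero)) (suc b)
    drop = subst₂ ℚ._<_ (value {y} ℓy) (value {i} ℓi) (below y (≢i ℓy (<⇒≢ (n<1+n (suc b)) ∘ sym)) y≢u)
    j≢1+b : j ≢ suc b
    j≢1+b j≡1+b = i≢u (toℕ-injective (label-injective (trans ℓi (trans (cong curve (sym j≡1+b)) (sym ℓu)))))

  OffPair : ℕ → ℕ → Set
  OffPair h x = x ≤ 3 + d × ⌊ x /2⌋ ≢ h

  axis-offPair : ∀ {u r h} → h ≤ 1 → label (toℕ u) ≡ axis r → OffPair h (toℕ u)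
  axis-offPair {u} {r} h≤1 ℓu = subst (OffPair _) (sym (toℕ-by-label {u} ℓu))
    (+-monoʳ-≤ 3 (toℕ<n r) , λ { refl → contradiction h≤1 λ { (s≤s ()) } })

  neighbour-of-curve-1 : ∀ {i u} → Edge v i u → label (toℕ i) ≡ curve 1 → OffPair 0 (toℕ u)
  neighbour-of-curve-1 {i} {u} edge ℓi = classify (label (toℕ u)) refl
    where
    classify : ∀ L → label (toℕ u) ≡ L → OffPair 0 (toℕ u)
    classify (axis r)  ℓu = axis-offPair {u} z≤n ℓu
    classify (curve j) ℓu with curve-neighbours edge ℓi ℓu (vertex 3 (m≤m+n 3 d)) (vertex 2 (≤3⇒≤3+d (n≤1+n 2)))
                                 (label-vertex 3 (m≤m+n 3 d)) (label-vertex 2 (≤3⇒≤3+d (n≤1+n 2)))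
    ... | inj₁ refl = subst (OffPair 0) (sym (toℕ-by-label {u} ℓu)) (m≤m+n 3 d , λ ())
    ... | inj₂ refl = subst (OffPair 0) (sym (toℕ-by-label {u} ℓu)) (≤3⇒≤3+d (n≤1+n 2) , λ ())

  neighbour-of-curve-2 : ∀ {i u} → Edge v i u → label (toℕ i) ≡ curve 2 → OffPair 1 (toℕ u)
  neighbour-of-curve-2 {i} {u} edge ℓi = classify (label (toℕ u)) refl
    where
    classify : ∀ L → label (toℕ u) ≡ L → OffPair 1 (toℕ u)
    classify (axis r)  ℓu = axis-offPair {u} (s≤s z≤n) ℓu
    classify (curve j) ℓu with curve-neighbours edge ℓi ℓu (vertex 0 z≤n) (vertex 1 (≤3⇒≤3+d (s≤s z≤n)))
                                 (label-vertex 0 z≤n) (label-vertex 1 (≤3⇒≤3+d (s≤s z≤n)))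
    ... | inj₁ refl = subst (OffPair 1) (sym (toℕ-by-label {u} ℓu)) (z≤n , λ ())
    ... | inj₂ refl = subst (OffPair 1) (sym (toℕ-by-label {u} ℓu)) (≤3⇒≤3+d (s≤s z≤n) , λ ())

module _ {n : ℕ} {E : Fin n → Fin n → Set} where

  source∈verts : ∀ {s t} (w : Walk E s t) → s ∈ verts w
  source∈verts here       = Any.here refl
  source∈verts (step _ _) = Any.here refl

  target∈verts : ∀ {s t} (w : Walk E s t) → t ∈ verts w
  target∈verts here       = Any.here refl
  target∈verts (step _ w) = there (target∈verts w)

  first-step : ∀ {s t} (w : Walk E s t) → s ≢ t → ∃ λ u → E s u × u ∈ verts w
  first-step here       s≢t = ⊥-elim (s≢t refl)
  first-step (step e w) _   = _ , e , there (source∈verts w)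

Disjoint : ∀ {n k} {E : Fin n → Fin n → Set} {s t : Fin k → Fin n} → (∀ i → Walk E (s i) (t i)) → Set
Disjoint {k = k} L = ∀ (i j : Fin k) x → x ∈ verts (L i) → x ∈ verts (L j) → i ≡ j

even⊎odd : ∀ x → x ≡ 2 * ⌊ x /2⌋ ⊎ x ≡ suc (2 * ⌊ x /2⌋)
even⊎odd 0 = inj₁ refl
even⊎odd 1 = inj₂ refl
even⊎odd (suc (suc x)) = Sum.map (λ even → trans (cong (2 +_) even) (sym (*-suc 2 ⌊ x /2⌋)))
                               (λ odd → trans (cong (2 +_) odd) (cong suc (sym (*-suc 2 ⌊ x /2⌋))))
                               (even⊎odd x)

module ConsecutivePairs {n k : ℕ} (2k≤n : 2 * k ≤ n) where

  source<n : ∀ (m : Fin k) → 2 * toℕ m < n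
  source<n m = <-≤-trans (*-monoʳ-< 2 (toℕ<n m)) 2k≤n

  target<n : ∀ (m : Fin k) → suc (2 * toℕ m) < n
  target<n m = ≤-trans (subst (_≤ 2 * k) (*-suc 2 (toℕ m)) (*-monoʳ-≤ 2 (toℕ<n m))) 2k≤n

  source target : Fin k → Fin n
  source m = fromℕ< (source<n m)
  target m = fromℕ< (target<n m)

  toℕ-source : ∀ m → toℕ (source m) ≡ 2 * toℕ m
  toℕ-source m = toℕ-fromℕ< (source<n m)

  toℕ-target : ∀ m → toℕ (target m) ≡ suc (2 * toℕ m)
  toℕ-target m = toℕ-fromℕ< (target<n m)

  distinct : Distinct2k source target
  distinct = (λ i j eq → toℕ-injective (*-cancelˡ-≡ (toℕ i) (toℕ j) 2 (via (toℕ-source i) eq (toℕ-source j))))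
           , (λ i j eq → toℕ-injective (*-cancelˡ-≡ (toℕ i) (toℕ j) 2
                                           (suc-injective (via (toℕ-target i) eq (toℕ-target j)))))
           , (λ i j eq → even≢odd (toℕ i) (toℕ j) (via (toℕ-source i) eq (toℕ-target j)))
    where
    via : ∀ {a b : Fin n} {x y} → toℕ a ≡ x → a ≡ b → toℕ b ≡ y → x ≡ y
    via a≡x refl b≡y = trans (sym a≡x) b≡y

  below-2k-terminal : ∀ x → toℕ x < 2 * k →
                      ∃ λ m → toℕ m ≡ ⌊ toℕ x /2⌋ × (x ≡ source m ⊎ x ≡ target m)
  below-2k-terminal x x<2k = m , toℕ-m , Sum.map at-source at-target (even⊎odd (toℕ x))
    where
    half : ℕ
    half = ⌊ toℕ x /2⌋
    2half≤x : 2 * half ≤ toℕ x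
    2half≤x = Sum.[ (λ even → ≤-reflexive (sym even)) , (λ odd → ≤-trans (n≤1+n _) (≤-reflexive (sym odd))) ]′
                  (even⊎odd (toℕ x))
    half<k : half < k
    half<k = *-cancelˡ-< 2 half k (≤-<-trans 2half≤x x<2k)
    m : Fin k
    m = fromℕ< half<k
    toℕ-m : toℕ m ≡ half
    toℕ-m = toℕ-fromℕ< half<k
    at-source : toℕ x ≡ 2 * half → x ≡ source m
    at-source even = toℕ-injective (trans even (sym (trans (toℕ-source m) (cong (2 *_) toℕ-m))))
    at-target : toℕ x ≡ suc (2 * half) → x ≡ target m
    at-target odd = toℕ-injective (trans odd (sym (trans (toℕ-target m) (cong (λ h → suc (2 * h)) toℕ-m))))

  module _ {E : Fin n → Fin n → Set} {L : ∀ m → Walk E (source m) (target m)} (disjoint : Disjoint L) where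

    off-pair-beyond : ∀ {a x} → x ∈ verts (L a) → ⌊ toℕ x /2⌋ ≢ toℕ a → 2 * k ≤ toℕ x
    off-pair-beyond {a} {x} x∈ off = ≮⇒≥ λ x<2k → beyond (below-2k-terminal x x<2k)
      where
      beyond : (∃ λ m → toℕ m ≡ ⌊ toℕ x /2⌋ × (x ≡ source m ⊎ x ≡ target m)) → ⊥
      beyond (m , m≡half , terminal) = off (trans (sym m≡half) (cong toℕ (disjoint m a x (terminal∈ terminal) x∈)))
        where
        terminal∈ : x ≡ source m ⊎ x ≡ target m → x ∈ verts (L m)
        terminal∈ (inj₁ refl) = source∈verts (L m)
        terminal∈ (inj₂ refl) = target∈verts (L m)

3+n≤2*[2+⌊n/2⌋] : ∀ d → 3 + d ≤ 2 * (2 + ⌊ d /2⌋)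
3+n≤2*[2+⌊n/2⌋] d = begin
  3 + d              ≤⟨ +-monoʳ-≤ 3 d≤1+2⌊d/2⌋ ⟩
  4 + 2 * ⌊ d /2⌋    ≡⟨ sym (*-distribˡ-+ 2 2 ⌊ d /2⌋) ⟩
  2 * (2 + ⌊ d /2⌋)  ∎
  where
  open ≤-Reasoning
  d≤1+2⌊d/2⌋ : d ≤ suc (2 * ⌊ d /2⌋)
  d≤1+2⌊d/2⌋ = Sum.[ (λ even → ≤-trans (≤-reflexive even) (n≤1+n _)) , ≤-reflexive ]′ (even⊎odd d)

module Obstruction (d γ : ℕ) where
  open Configuration d
  open Polytope d γ

  not-linked : ∀ {k} → suc (suc ⌊ d /2⌋) ≤ k → ¬ Linked (Edge v) k
  not-linked {k} k≥@(s≤s (s≤s _)) (2k≤n , link) =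
    let L , _ , disjoint = link source target distinct
        u₀ , u₀∈ , u₀-at-gap = reaches-gap disjoint zero
                                 (λ e → neighbour-of-curve-1 e (cong label (toℕ-source zero)))
        u₁ , u₁∈ , u₁-at-gap = reaches-gap disjoint (suc zero)
                                 (λ e → neighbour-of-curve-2 e (cong label (toℕ-source (suc zero))))
        u₁≡u₀ = toℕ-injective (trans u₁-at-gap (sym u₀-at-gap))
    in contradiction (disjoint zero (suc zero) u₀ u₀∈ (subst (_∈ verts (L (suc zero))) u₁≡u₀ u₁∈)) λ ()
    where
    open ConsecutivePairs {n} {k} 2k≤n
    -- d + 3 is the only index ≤ d + 3 that is not a terminal.
    reaches-gap : ∀ {L : ∀ m → Walk (Edge v) (source m) (target m)} → Disjoint L →
                  ∀ a → (∀ {u} → Edge v (source a) u → OffPair (toℕ a) (toℕ u)) →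
                  ∃ λ u → u ∈ verts (L a) × toℕ u ≡ 3 + d
    reaches-gap {L} disjoint a neighbour with first-step (L a) (proj₂ (proj₂ distinct) a a)
    ... | u , edge , u∈ with neighbour edge
    ...   | u≤3+d , off = u , u∈ , ≤-antisym u≤3+d (≤-trans 3+d≤2k (off-pair-beyond disjoint u∈ off))
      where
      3+d≤2k : 3 + d ≤ 2 * k
      3+d≤2k = ≤-trans (3+n≤2*[2+⌊n/2⌋] d) (*-monoʳ-≤ 2 k≥)

theorem2p3 : ∀ (d γ : ℕ) → 2 ≤ d → 1 ≤ γ →
    ¬ (∀ (v : Fin (d + γ + 1) → Fin d → ℚ) → IsPolytope d (d + γ + 1) v →
    ∃ λ k → (suc ⌊ d /2⌋ ≤ k) × Linked (Edge v) k)
theorem2p3 _ _ (s≤s (s≤s {n = d} _)) (s≤s {n = γ} _) allLinked =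
  let k , k≥ , linked = allLinked v isPolytope in not-linked k≥ linked
  where
  open Polytope d γ
  open Obstruction d γ
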